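{- Let $n\geq 2$ be an integer and let $S$ be a sequence in $\mathbb Z_n$. Then $S$ is a $C$-extremal sequence for $(\mathbb Z_n',\{1\})$ if and only if $S$ is a translate of a sequence which is order-equivalent to the sequence $(0,1,0)$.
   Context: $\mathbb Z_n=\mathbb Z/n\mathbb Z$ as a module over itself and $\mathbb Z_n'=\mathbb Z_n\setminus\{0\}$. For non-empty $A,B\subseteq\mathbb Z_n$, a sequence $(x_1,\ldots,x_k)$ is an $(A,B)$-weighted zero-sum sequence if there exist $a_i\in A$, $b_i\in B$ with $\sum a_ix_i=0$ and $\sum b_ia_i=0$. $C_{A,B}(n)$ is the least positive $k$ such that every sequence of length $k$ in $\mathbb Z_n$ has an $(A,B)$-weighted zero-sum subsequence having consecutive terms (a non-empty block $(x_i,\ldots,x_j)$); a $C$-extremal sequence for $(A,B)$ is a sequence of length $C_{A,B}(n)-1$ having no such subsequence. A translate of $(x_1,\ldots,x_k)$ is $(x_1+x,\ldots,x_k+x)$ for some $x\in\mathbb Z_n$. Sequences $(x_1,\ldots,x_k)$ and $(y_1,\ldots,y_k)$ are order-equivalent if there is a unit $u\in\mathbb Z_n$ with $y_i=ux_i$ for all $i$. -}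

module Defs where

open import Data.Nat using (ℕ; suc; _+_; _*_; _≤_; _<_; NonZero)
open import Data.Nat.DivMod using (_%_)
open import Data.Nat.Divisibility using (_∣_)
open import Data.Fin using (Fin; toℕ)
open import Data.List using (List; []; _∷_; _++_; length; zipWith; map)
open import Data.Nat.ListAction using (sum)
open import Data.List.Relation.Unary.All using (All)
open import Data.List.Relation.Binary.Pointwise using (Pointwise)
open import Data.Product using (Σ; ∃; _×_)
open import Relation.Binary.PropositionalEquality using (_≡_; _≢_)
open import Relation.Nullary using (¬_)

-- Z_n is represented by Fin n; arithmetic is done on representatives toℕ and
-- read modulo n.

wsum : ∀ {n} → List (Fin n) → List (Fin n) → ℕ
wsum cs ys = sum (zipWith (λ c y → toℕ c * toℕ y) cs ys)

WZS : (n : ℕ) → (A B : Fin n → Set) → List (Fin n) → Set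
WZS n A B xs =
  Σ (List (Fin n)) λ as → Σ (List (Fin n)) λ bs →
    length as ≡ length xs × length bs ≡ length xs ×
    All A as × All B bs ×
    n ∣ wsum as xs × n ∣ wsum bs as

HasZSBlock : (n : ℕ) → (A B : Fin n → Set) → List (Fin n) → Set
HasZSBlock n A B xs =
  Σ (List (Fin n)) λ pre → Σ (List (Fin n)) λ blk → Σ (List (Fin n)) λ post →
    xs ≡ pre ++ blk ++ post × blk ≢ [] × WZS n A B blk

AllHaveBlock : (n : ℕ) → (A B : Fin n → Set) → ℕ → Set
AllHaveBlock n A B k = ∀ (xs : List (Fin n)) → length xs ≡ k → HasZSBlock n A B xs

IsC : (n : ℕ) → (A B : Fin n → Set) → ℕ → Set
IsC n A B k =
  1 ≤ k × AllHaveBlock n A B k ×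
  (∀ k′ → 1 ≤ k′ → k′ < k → ¬ AllHaveBlock n A B k′)

CExtremal : (n : ℕ) → (A B : Fin n → Set) → List (Fin n) → Set
CExtremal n A B S =
  ∃ λ k → IsC n A B k × suc (length S) ≡ k × ¬ HasZSBlock n A B S

Zn′ : (n : ℕ) → Fin n → Set
Zn′ n a = toℕ a ≢ 0

-- the singleton {1} (for n ≥ 2 the element 1 of Z_n has representative 1)
One : (n : ℕ) → Fin n → Set
One n b = toℕ b ≡ 1

IsUnit : (n : ℕ) .{{_ : NonZero n}} → Fin n → Set
IsUnit n u = ∃ λ (v : Fin n) → (toℕ u * toℕ v) % n ≡ 1 % n

IsTranslate : (n : ℕ) .{{_ : NonZero n}} → List (Fin n) → List (Fin n) → Set
IsTranslate n xs ys =
  ∃ λ (x : Fin n) → Pointwise (λ xi yi → toℕ yi ≡ (toℕ xi + toℕ x) % n) xs ys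

OrderEquiv : (n : ℕ) .{{_ : NonZero n}} → List (Fin n) → List (Fin n) → Set
OrderEquiv n xs ys =
  ∃ λ (u : Fin n) → IsUnit n u ×
    Pointwise (λ xi yi → toℕ yi ≡ (toℕ u * toℕ xi) % n) xs ys

-- With weights in Z_n ∖ {0} and B = {1}, a block is zero-sum iff its nonzero weights a_k satisfy
-- Σ a_k ≡ 0 and Σ a_k x_k ≡ 0. A single term is never such a block, and a pair (p, q) is one
-- exactly when q - p is a zero divisor (0 included). Every residue is a unit or a zero divisor
-- (according to its gcd with n). If in (p, q, r) both q - p and r - q are units and r ≠ p, the
-- weights ((r - p) e - 1, -(r - p) e, 1) with e = (q - p)⁻¹ give a block; in (p, q, p) any weights
-- force a₂ (q - p) ≡ 0, so there is none. Since (p, q, p, q) always has the block with weights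
-- (1, 1, -1, -1), C = 4 and the extremal sequences are the (p, q, p) with q - p a unit, i.e. the
-- translates of unit multiples of (0, 1, 0).

module Submission where

open import Defs
open import Data.Nat using (ℕ; _≤_; NonZero)
open import Data.Fin using (Fin; toℕ)
open import Data.List using (List; []; _∷_; map)
open import Data.Product using (Σ; _×_)
open import Function.Bundles using (_⇔_)
open import Relation.Binary.PropositionalEquality using (_≡_)

open import Data.Nat as ℕ using (suc; zero; _<_; z≤n; s≤s)
import Data.Nat.Properties as ℕ
open import Data.Nat.DivMod using (_%_; m<n⇒m%n≡m; m%n<n)
import Data.Nat.Divisibility as ℕ
open import Data.Nat.GCD using (gcd; gcd[m,n]∣m; gcd[m,n]∣n; gcd[m,n]≢0; module Bézout)
open import Data.Nat.Coprimality using (gcd≡1⇒coprime; coprime-Bézout)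
open import Data.Fin using (fromℕ<; _≟_)
open import Data.Fin.Properties using (toℕ<n; toℕ-injective; toℕ-fromℕ<)
open import Data.Integer as ℤ using (ℤ; +_; _+_; _*_; _-_; -_)
open import Data.Integer.Properties
  using (pos-+; pos-*; m-n≡m⊖n; ∣m⊝n∣≤m⊔n; ∣i∣≡0⇒i≡0; i-j≡0⇒i≡j; +-injective;
         *-identityˡ; +-identityʳ)
open import Data.Integer.DivMod using (_%ℕ_; _/ℕ_; n%ℕd<d; a≡a%ℕn+[a/ℕn]*n)
open import Data.Integer.Divisibility.Signed using (_∣_; divides; ∣⇒∣ᵤ; ∣ᵤ⇒∣; ∣m∣n⇒∣m+n; ∣n⇒∣m*n)
open import Data.Integer.Tactic.RingSolver using (solve-∀)
open import Data.List using (_++_; length; foldr; zipWith; replicate; take; drop)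
open import Data.List.Properties
  using (++-assoc; ++-identityʳ; map-injective; length-map; length-replicate; length-take; take++drop≡id)
open import Data.List.Relation.Unary.All using (All; []; _∷_)
open import Data.List.Relation.Unary.All.Properties using (gmap⁺; replicate⁺)
open import Data.List.Relation.Binary.Pointwise using ([]; _∷_)
open import Data.Product using (∃; _,_)
open import Data.Sum using (_⊎_; inj₁; inj₂)
open import Data.Empty using (⊥-elim)
open import Function.Bundles using (mk⇔; Equivalence)
open import Relation.Nullary using (¬_; yes; no)
open import Relation.Binary.Definitions using (tri<; tri≈; tri>)
open import Relation.Binary.PropositionalEquality
  using (_≢_; refl; sym; trans; cong; cong₂; subst; module ≡-Reasoning)

∣-linear : ∀ {k h₁ h₂} c₁ c₂ → k ∣ h₁ → k ∣ h₂ → k ∣ c₁ * h₁ + c₂ * h₂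
∣-linear c₁ c₂ k∣h₁ k∣h₂ = ∣m∣n⇒∣m+n (∣n⇒∣m*n c₁ k∣h₁) (∣n⇒∣m*n c₂ k∣h₂)

∣-≡ : ∀ {k i j} → i ≡ j → k ∣ i → k ∣ j
∣-≡ {k} = subst (k ∣_)

∣0 : ∀ {k} → k ∣ + 0
∣0 = divides (+ 0) refl

∣-transfer : ∀ {k i j} → k ∣ i - j → k ∣ j → k ∣ i
∣-transfer {k} {i} {j} k∣i-j k∣j = ∣-≡ (identity i j) (∣m∣n⇒∣m+n k∣i-j k∣j)
  where
  identity : ∀ i j → i - j + j ≡ i
  identity = solve-∀

sumℤ : List ℤ → ℤ
sumℤ = foldr _+_ (+ 0)

module _ {n : ℕ} {A B : Fin n → Set} where

  HasZSBlock-++ʳ : ∀ {xs} → HasZSBlock n A B xs → ∀ ys → HasZSBlock n A B (xs ++ ys)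
  HasZSBlock-++ʳ (pre , blk , post , refl , blk≢[] , w) ys =
    pre , blk , post ++ ys ,
    trans (++-assoc pre (blk ++ post) ys) (cong (pre ++_) (++-assoc blk post ys)) , blk≢[] , w

  HasZSBlock-∷ : ∀ x {xs} → HasZSBlock n A B xs → HasZSBlock n A B (x ∷ xs)
  HasZSBlock-∷ x (pre , blk , post , eq , blk≢[] , w) = x ∷ pre , blk , post , cong (x ∷_) eq , blk≢[] , w

  HasZSBlock-triple : ∀ {x y z} → HasZSBlock n A B (x ∷ y ∷ z ∷ []) →
    (∃ λ w → WZS n A B (w ∷ [])) ⊎
    WZS n A B (x ∷ y ∷ []) ⊎ WZS n A B (y ∷ z ∷ []) ⊎ WZS n A B (x ∷ y ∷ z ∷ [])
  HasZSBlock-triple (_ , [] , _ , _ , blk≢[] , _) = ⊥-elim (blk≢[] refl)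
  HasZSBlock-triple ([]        , _ ∷ []         , _ , refl , _ , w) = inj₁ (_ , w)
  HasZSBlock-triple (_ ∷ []    , _ ∷ []         , _ , refl , _ , w) = inj₁ (_ , w)
  HasZSBlock-triple (_ ∷ _ ∷ [] , _ ∷ []        , _ , refl , _ , w) = inj₁ (_ , w)
  HasZSBlock-triple ([]        , _ ∷ _ ∷ []     , _ , refl , _ , w) = inj₂ (inj₁ w)
  HasZSBlock-triple (_ ∷ []    , _ ∷ _ ∷ []     , _ , refl , _ , w) = inj₂ (inj₂ (inj₁ w))
  HasZSBlock-triple ([]        , _ ∷ _ ∷ _ ∷ [] , _ , refl , _ , w) = inj₂ (inj₂ (inj₂ w))
  HasZSBlock-triple ([] , _ ∷ _ ∷ _ ∷ _ ∷ _ , _ , () , _ , _)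
  HasZSBlock-triple (_ ∷ [] , _ ∷ _ ∷ _ ∷ _ , _ , () , _ , _)
  HasZSBlock-triple (_ ∷ _ ∷ [] , _ ∷ _ ∷ _ , _ , () , _ , _)
  HasZSBlock-triple (_ ∷ _ ∷ _ ∷ [] , _ ∷ _ , _ , () , _ , _)
  HasZSBlock-triple (_ ∷ _ ∷ _ ∷ _ ∷ _ , _ ∷ _ , _ , () , _ , _)

  IsC-unique : ∀ {k k′} → IsC n A B k → IsC n A B k′ → k ≡ k′
  IsC-unique {k} {k′} (1≤k , all-k , below-k) (1≤k′ , all-k′ , below-k′) with ℕ.<-cmp k k′
  ... | tri< k<k′ _ _ = ⊥-elim (below-k′ k 1≤k k<k′ all-k)
  ... | tri≈ _ k≡k′ _ = k≡k′
  ... | tri> _ _ k′<k = ⊥-elim (below-k k′ 1≤k′ k′<k all-k′)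

  CExtremal⇔ : ∀ {k S} → IsC n A B k → CExtremal n A B S ⇔ (suc (length S) ≡ k × ¬ HasZSBlock n A B S)
  CExtremal⇔ {k} isC = mk⇔
    (λ (k′ , isC′ , len , free) → trans len (IsC-unique isC′ isC) , free)
    (λ (len , free) → k , isC , len , free)

module Residues (n : ℕ) .{{_ : NonZero n}} where

  ι : Fin n → ℤ
  ι x = + toℕ x

  <n-∣⇒≡0 : ∀ {a} → a < n → n ℕ.∣ a → a ≡ 0
  <n-∣⇒≡0 {zero}  _   _   = refl
  <n-∣⇒≡0 {suc a} a<n n∣a = ⊥-elim (ℕ.>⇒∤ a<n n∣a)

  ∣-residue-diff⇒≡ : ∀ {a b} → a < n → b < n → + n ∣ + a - + b → a ≡ b
  ∣-residue-diff⇒≡ {a} {b} a<n b<n n∣a-b =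
    +-injective (i-j≡0⇒i≡j (+ a) (+ b) (∣i∣≡0⇒i≡0 (<n-∣⇒≡0 ∣a-b∣<n (∣⇒∣ᵤ n∣a-b))))
    where
    ∣a-b∣<n : ℤ.∣ + a - + b ∣ < n
    ∣a-b∣<n = ℕ.≤-<-trans (subst (λ t → ℤ.∣ t ∣ ℕ.≤ a ℕ.⊔ b) (sym (m-n≡m⊖n a b))
                                 (∣m⊝n∣≤m⊔n a b))
                          (ℕ.⊔-lub a<n b<n)

  ∣%ℕ-diff : ∀ w → + n ∣ + (w %ℕ n) - w
  ∣%ℕ-diff w = divides (- (w /ℕ n)) (begin
    + (w %ℕ n) - w                                  ≡⟨ cong (_-_ (+ (w %ℕ n))) (a≡a%ℕn+[a/ℕn]*n w n) ⟩
    + (w %ℕ n) - (+ (w %ℕ n) + (w /ℕ n) * + n)      ≡⟨ cancel (+ (w %ℕ n)) (w /ℕ n) (+ n) ⟩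
    - (w /ℕ n) * + n                                ∎)
    where
    open ≡-Reasoning
    cancel : ∀ r q k → r - (r + q * k) ≡ - q * k
    cancel = solve-∀

  %≡⇒∣- : ∀ {a b} → a % n ≡ b % n → + n ∣ + a - + b
  %≡⇒∣- {a} {b} eq = ∣-≡ (rearrange (+ (b % n)) (+ a) (+ b))
    (∣-linear (+ 1) (- + 1) (∣%ℕ-diff (+ b)) (subst (λ r → + n ∣ + r - + a) eq (∣%ℕ-diff (+ a))))
    where
    rearrange : ∀ r a b → + 1 * (r - b) + - + 1 * (r - a) ≡ a - b
    rearrange = solve-∀

  ∣-⇒%≡ : ∀ {a b} → + n ∣ + a - + b → a % n ≡ b % n
  ∣-⇒%≡ {a} {b} n∣a-b = ∣-residue-diff⇒≡ (m%n<n a n) (m%n<n b n)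
    (∣-≡ (rearrange (+ (a % n)) (+ (b % n)) (+ a) (+ b))
      (∣m∣n⇒∣m+n (∣m∣n⇒∣m+n (∣%ℕ-diff (+ a)) n∣a-b) (∣n⇒∣m*n (- + 1) (∣%ℕ-diff (+ b)))))
    where
    rearrange : ∀ r s a b → (r - a) + (a - b) + - + 1 * (s - b) ≡ r - s
    rearrange = solve-∀

  ι-injective : ∀ {x y} → + n ∣ ι x - ι y → x ≡ y
  ι-injective {x} {y} n∣x-y = toℕ-injective (∣-residue-diff⇒≡ (toℕ<n x) (toℕ<n y) n∣x-y)

  ∣⇒toℕ≡% : ∀ {y a} → + n ∣ ι y - + a → toℕ y ≡ a % n
  ∣⇒toℕ≡% {y} n∣y-a = trans (sym (m<n⇒m%n≡m (toℕ<n y))) (∣-⇒%≡ n∣y-a)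

  toℕ≡%⇒∣ : ∀ {y} a → toℕ y ≡ a % n → + n ∣ ι y - + a
  toℕ≡%⇒∣ {y} a eq = subst (λ r → + n ∣ + r - + a) (sym eq) (∣%ℕ-diff (+ a))

  reduce : ℤ → Fin n
  reduce w = fromℕ< (n%ℕd<d w n)

  ∣reduce- : ∀ w → + n ∣ ι (reduce w) - w
  ∣reduce- w = subst (λ r → + n ∣ + r - w) (sym (toℕ-fromℕ< (n%ℕd<d w n))) (∣%ℕ-diff w)

  Invertible : ℤ → Set
  Invertible z = ∃ λ e → + n ∣ z * e - + 1

  ZeroDivisor : ℤ → Set
  ZeroDivisor z = ∃ λ a → ¬ + n ∣ a × + n ∣ a * z

  invertible-cancel : ∀ {z a} → Invertible z → + n ∣ a * z → + n ∣ a
  invertible-cancel {z} {a} (e , n∣ze-1) n∣az =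
    ∣-≡ (identity z e a) (∣-linear e (- a) n∣az n∣ze-1)
    where
    identity : ∀ z e a → e * (a * z) + - a * (z * e - + 1) ≡ a
    identity = solve-∀

  invertible⇒¬zeroDivisor : ∀ {z} → Invertible z → ¬ ZeroDivisor z
  invertible⇒¬zeroDivisor inv (a , n∤a , n∣az) = n∤a (invertible-cancel inv n∣az)

  ∤-neg : ∀ {a} → ¬ + n ∣ a → ¬ + n ∣ - a
  ∤-neg {a} n∤a n∣-a = n∤a (∣-≡ (identity a) (∣n⇒∣m*n (- + 1) n∣-a))
    where
    identity : ∀ a → - + 1 * - a ≡ a
    identity = solve-∀

  invertible-resp : ∀ {z z′} → + n ∣ z - z′ → Invertible z → Invertible z′
  invertible-resp {z} {z′} n∣z-z′ (e , n∣ze-1) =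
    e , ∣-≡ (identity z z′ e) (∣-linear (+ 1) (- e) n∣ze-1 n∣z-z′)
    where
    identity : ∀ z z′ e → + 1 * (z * e - + 1) + - e * (z - z′) ≡ z′ * e - + 1
    identity = solve-∀

  invertible-swap : ∀ {a b} → Invertible (a - b) → Invertible (b - a)
  invertible-swap {a} {b} (e , n∣[a-b]e-1) = - e , ∣-≡ (identity a b e) n∣[a-b]e-1
    where
    identity : ∀ a b e → (a - b) * e - + 1 ≡ (b - a) * - e - + 1
    identity = solve-∀

  zeroDivisor-resp : ∀ {z z′} → + n ∣ z - z′ → ZeroDivisor z → ZeroDivisor z′
  zeroDivisor-resp {z} {z′} n∣z-z′ (a , n∤a , n∣az) =
    a , n∤a , ∣-≡ (identity z z′ a) (∣-linear (+ 1) (- a) n∣az n∣z-z′)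
    where
    identity : ∀ z z′ a → + 1 * (a * z) + - a * (z - z′) ≡ a * z′
    identity = solve-∀

  bézout⇒invertible : ∀ {m} → Bézout.Identity 1 m n → Invertible (+ m)
  bézout⇒invertible {m} (Bézout.+- x y eq) = + x , divides (+ y) (begin
    + m * + x - + 1          ≡⟨ solve₁ (+ m) (+ x) ⟩
    + x * + m - + 1          ≡⟨ cong (_- + 1) (lift-* x m) ⟩
    + (x ℕ.* m) - + 1        ≡⟨ cong (λ t → + t - + 1) (sym eq) ⟩
    + (1 ℕ.+ y ℕ.* n) - + 1  ≡⟨ cong (_- + 1) (pos-+ 1 (y ℕ.* n)) ⟩
    + 1 + + (y ℕ.* n) - + 1  ≡⟨ solve₂ (+ (y ℕ.* n)) ⟩
    + (y ℕ.* n)              ≡⟨ pos-* y n ⟩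
    + y * + n                ∎)
    where
    open ≡-Reasoning
    lift-* : ∀ a b → + a * + b ≡ + (a ℕ.* b)
    lift-* a b = sym (pos-* a b)
    solve₁ : ∀ a b → a * b - + 1 ≡ b * a - + 1
    solve₁ = solve-∀
    solve₂ : ∀ a → + 1 + a - + 1 ≡ a
    solve₂ = solve-∀
  bézout⇒invertible {m} (Bézout.-+ x y eq) = - + x , divides (- + y) (begin
    + m * - + x - + 1        ≡⟨ solve₁ (+ m) (+ x) ⟩
    - (+ 1 + + x * + m)      ≡⟨ cong (λ t → - (+ 1 + t)) (sym (pos-* x m)) ⟩
    - (+ 1 + + (x ℕ.* m))    ≡⟨ cong -_ (sym (pos-+ 1 (x ℕ.* m))) ⟩
    - + (1 ℕ.+ x ℕ.* m)      ≡⟨ cong (λ t → - + t) eq ⟩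
    - + (y ℕ.* n)            ≡⟨ cong -_ (pos-* y n) ⟩
    - (+ y * + n)            ≡⟨ solve₂ (+ y) (+ n) ⟩
    - + y * + n              ∎)
    where
    open ≡-Reasoning
    solve₁ : ∀ a b → a * - b - + 1 ≡ - (+ 1 + b * a)
    solve₁ = solve-∀
    solve₂ : ∀ a b → - (a * b) ≡ - a * b
    solve₂ = solve-∀

  gcd≢1⇒zeroDivisor : ∀ m → gcd m n ≢ 1 → ZeroDivisor (+ m)
  gcd≢1⇒zeroDivisor m g≢1
    with gcd m n | gcd[m,n]∣m m n | gcd[m,n]∣n m n | gcd[m,n]≢0 m n (inj₂ (ℕ.≢-nonZero⁻¹ n))
  ... | 0           | _              | _               | g≢0 = ⊥-elim (g≢0 refl)
  ... | 1           | _              | _               | _   = ⊥-elim (g≢1 refl)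
  ... | suc (suc g) | ℕ.divides c m≡cg | ℕ.divides b n≡bg | _   = + b , n∤b , divides (+ c) (begin
    + b * + m                      ≡⟨ cong (λ t → + b * + t) m≡cg ⟩
    + b * + (c ℕ.* suc (suc g))    ≡⟨ cong (+ b *_) (pos-* c (suc (suc g))) ⟩
    + b * (+ c * + suc (suc g))    ≡⟨ swap (+ b) (+ c) (+ suc (suc g)) ⟩
    + c * (+ b * + suc (suc g))    ≡⟨ cong (+ c *_) (sym (pos-* b (suc (suc g)))) ⟩
    + c * + (b ℕ.* suc (suc g))    ≡⟨ cong (λ t → + c * + t) (sym n≡bg) ⟩
    + c * + n                      ∎)
    where
    open ≡-Reasoning
    swap : ∀ x y z → x * (y * z) ≡ y * (x * z)
    swap = solve-∀
    b≢0 : b ≢ 0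
    b≢0 refl = ℕ.≢-nonZero⁻¹ n n≡bg
    b<n : b < n
    b<n = subst (b <_) (sym n≡bg) (ℕ.m<m*n b (suc (suc g)) {{ℕ.≢-nonZero b≢0}} (s≤s (s≤s z≤n)))
    n∤b : ¬ + n ∣ + b
    n∤b n∣b = b≢0 (<n-∣⇒≡0 b<n (∣⇒∣ᵤ n∣b))

  invertible-or-zeroDivisor : ∀ z → Invertible z ⊎ ZeroDivisor z
  invertible-or-zeroDivisor z with gcd (z %ℕ n) n ℕ.≟ 1
  ... | yes g≡1 = inj₁ (invertible-resp {+ (z %ℕ n)} {z} (∣%ℕ-diff z)
                         (bézout⇒invertible {z %ℕ n} (coprime-Bézout (gcd≡1⇒coprime g≡1))))
  ... | no  g≢1 = inj₂ (zeroDivisor-resp {+ (z %ℕ n)} {z} (∣%ℕ-diff z) (gcd≢1⇒zeroDivisor (z %ℕ n) g≢1))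

  weighted : List ℤ → List (Fin n) → ℤ
  weighted ws xs = sumℤ (zipWith (λ w x → w * ι x) ws xs)

  -- The weights a_i lifted to ℤ; with B = {1} the condition Σ b_i a_i ≡ 0 reads Σ a_i ≡ 0.
  record ZeroSumWeights (xs : List (Fin n)) : Set where
    constructor zeroSumWeights
    field
      weights      : List ℤ
      length≡      : length weights ≡ length xs
      nonzero      : All (λ w → ¬ + n ∣ w) weights
      sum≡0        : + n ∣ sumℤ weights
      weighted≡0   : + n ∣ weighted weights xs

  wsum≡weighted : ∀ as xs → + wsum as xs ≡ weighted (map ι as) xs
  wsum≡weighted []       _        = refl
  wsum≡weighted (_ ∷ _)  []       = refl
  wsum≡weighted (a ∷ as) (x ∷ xs) = trans (pos-+ (toℕ a ℕ.* toℕ x) (wsum as xs))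
    (cong₂ _+_ (pos-* (toℕ a) (toℕ x)) (wsum≡weighted as xs))

  wsum-ones≡sum : ∀ {bs} as → All (One n) bs → length bs ≡ length as → + wsum bs as ≡ sumℤ (map ι as)
  wsum-ones≡sum          []       []           _   = refl
  wsum-ones≡sum {b ∷ bs} (a ∷ as) (b≡1 ∷ bs≡1) len = trans (pos-+ (toℕ b ℕ.* toℕ a) (wsum bs as))
    (cong₂ _+_ (cong +_ (trans (cong (ℕ._* toℕ a) b≡1) (ℕ.*-identityˡ (toℕ a))))
               (wsum-ones≡sum as bs≡1 (ℕ.suc-injective len)))

  sum-reduce : ∀ ws → + n ∣ sumℤ (map ι (map reduce ws)) - sumℤ ws
  sum-reduce []       = ∣0
  sum-reduce (w ∷ ws) = ∣-≡ (identity (ι (reduce w)) w (sumℤ (map ι (map reduce ws))) (sumℤ ws))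
                             (∣m∣n⇒∣m+n (∣reduce- w) (sum-reduce ws))
    where
    identity : ∀ a w s t → (a - w) + (s - t) ≡ (a + s) - (w + t)
    identity = solve-∀

  weighted-reduce : ∀ ws xs → + n ∣ weighted (map ι (map reduce ws)) xs - weighted ws xs
  weighted-reduce []       _        = ∣0
  weighted-reduce (_ ∷ _)  []       = ∣0
  weighted-reduce (w ∷ ws) (x ∷ xs) =
    ∣-≡ (identity (ι (reduce w)) w (ι x) (weighted (map ι (map reduce ws)) xs) (weighted ws xs))
        (∣m∣n⇒∣m+n (∣n⇒∣m*n (ι x) (∣reduce- w)) (weighted-reduce ws xs))
    where
    identity : ∀ a w x s t → x * (a - w) + (s - t) ≡ (a * x + s) - (w * x + t)
    identity = solve-∀

  Zn′⇒∤ : ∀ {a} → Zn′ n a → ¬ + n ∣ ι a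
  Zn′⇒∤ {a} a≢0 n∣a = a≢0 (<n-∣⇒≡0 (toℕ<n a) (∣⇒∣ᵤ n∣a))

  ∤⇒Zn′-reduce : ∀ {w} → ¬ + n ∣ w → Zn′ n (reduce w)
  ∤⇒Zn′-reduce {w} n∤w w′≡0 = n∤w (∣-≡ (identity w) (∣n⇒∣m*n (- + 1) n∣0-w))
    where
    n∣0-w : + n ∣ + 0 - w
    n∣0-w = subst (λ r → + n ∣ + r - w) w′≡0 (∣reduce- w)
    identity : ∀ w → - + 1 * (+ 0 - w) ≡ w
    identity = solve-∀

  invertible⇒isUnit-reduce : ∀ {z} → Invertible z → IsUnit n (reduce z)
  invertible⇒isUnit-reduce {z} (e , n∣ze-1) = reduce e , ∣-⇒%≡ (∣-≡ (identity z e) (∣m∣n⇒∣m+n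
    (∣-linear (ι (reduce e)) z (∣reduce- z) (∣reduce- e)) n∣ze-1))
    where
    expand : ∀ u v z e → v * (u - z) + z * (v - e) + (z * e - + 1) ≡ u * v - + 1
    expand = solve-∀
    identity : ∀ z e → ι (reduce e) * (ι (reduce z) - z) + z * (ι (reduce e) - e) + (z * e - + 1)
                     ≡ + (toℕ (reduce z) ℕ.* toℕ (reduce e)) - + 1
    identity z e = trans (expand (ι (reduce z)) (ι (reduce e)) z e)
                         (cong (_- + 1) (sym (pos-* (toℕ (reduce z)) (toℕ (reduce e)))))

  isUnit⇒invertible : ∀ {u} → IsUnit n u → Invertible (ι u)
  isUnit⇒invertible {u} (v , uv≡1) = ι v , ∣-≡ (cong (_- + 1) (pos-* (toℕ u) (toℕ v))) (%≡⇒∣- uv≡1)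

-- Writing n = 2 + m makes 0 and 1 available as constructors of Fin n.
module Extremal (m : ℕ) where

  n : ℕ
  n = suc (suc m)

  open Residues n

  one : Fin n
  one = Fin.suc Fin.zero

  S₀₁₀ : List (Fin n)
  S₀₁₀ = Fin.zero ∷ one ∷ Fin.zero ∷ []

  n∤1 : ¬ + n ∣ + 1
  n∤1 n∣1 with <n-∣⇒≡0 {1} (s≤s (s≤s z≤n)) (∣⇒∣ᵤ n∣1)
  ... | ()

  invertible⇒∤ : ∀ {z} → Invertible z → ¬ + n ∣ z
  invertible⇒∤ {z} inv n∣z = n∤1 (invertible-cancel inv (∣-≡ (sym (*-identityˡ z)) n∣z))

  WZS⇒zeroSumWeights : ∀ {xs} → WZS n (Zn′ n) (One n) xs → ZeroSumWeights xs
  WZS⇒zeroSumWeights {xs} (as , bs , |as| , |bs| , as≢0 , bs≡1 , n∣Σax , n∣Σba) = zeroSumWeights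
    (map ι as) (trans (length-map ι as) |as|) (gmap⁺ Zn′⇒∤ as≢0)
    (∣-≡ (wsum-ones≡sum as bs≡1 (trans |bs| (sym |as|))) (∣ᵤ⇒∣ n∣Σba))
    (∣-≡ (wsum≡weighted as xs) (∣ᵤ⇒∣ n∣Σax))

  zeroSumWeights⇒WZS : ∀ {xs} → ZeroSumWeights xs → WZS n (Zn′ n) (One n) xs
  zeroSumWeights⇒WZS {xs} (zeroSumWeights ws |ws| ws≢0 n∣Σw n∣Σwx) =
    as , bs , trans (length-map reduce ws) |ws| , trans (length-replicate (length ws)) |ws| ,
    gmap⁺ ∤⇒Zn′-reduce ws≢0 , replicate⁺ (length ws) refl ,
    ∣⇒∣ᵤ (∣-≡ (sym (wsum≡weighted as xs)) (∣-transfer (weighted-reduce ws xs) n∣Σwx)) ,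
    ∣⇒∣ᵤ (∣-≡ (sym (wsum-ones≡sum as (replicate⁺ (length ws) refl) |bs|≡|as|))
              (∣-transfer (sum-reduce ws) n∣Σw))
    where
    as bs : List (Fin n)
    as = map reduce ws
    bs = replicate (length ws) one
    |bs|≡|as| : length bs ≡ length as
    |bs|≡|as| = trans (length-replicate (length ws)) (sym (length-map reduce ws))

  ¬zeroSumWeights-singleton : ∀ {x} → ¬ ZeroSumWeights (x ∷ [])
  ¬zeroSumWeights-singleton (zeroSumWeights (a ∷ []) _ (n∤a ∷ []) n∣a+0 _) =
    n∤a (∣-≡ (+-identityʳ a) n∣a+0)

  zeroSumWeights-pair⇔ : ∀ {p q} → ZeroSumWeights (p ∷ q ∷ []) ⇔ ZeroDivisor (ι q - ι p)
  zeroSumWeights-pair⇔ {p} {q} = mk⇔ to from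
    where
    to : ZeroSumWeights (p ∷ q ∷ []) → ZeroDivisor (ι q - ι p)
    to (zeroSumWeights (a₁ ∷ a₂ ∷ []) _ (_ ∷ n∤a₂ ∷ []) n∣Σa n∣Σax) =
      a₂ , n∤a₂ , ∣-≡ (identity a₁ a₂ (ι p) (ι q)) (∣-linear (+ 1) (- ι p) n∣Σax n∣Σa)
      where
      identity : ∀ a₁ a₂ p q → + 1 * (a₁ * p + (a₂ * q + + 0)) + - p * (a₁ + (a₂ + + 0)) ≡ a₂ * (q - p)
      identity = solve-∀
    from : ZeroDivisor (ι q - ι p) → ZeroSumWeights (p ∷ q ∷ [])
    from (a , n∤a , n∣a[q-p]) = zeroSumWeights (- a ∷ a ∷ []) refl (∤-neg n∤a ∷ n∤a ∷ [])
      (∣-≡ (sum-identity a) ∣0) (∣-≡ (weighted-identity a (ι p) (ι q)) n∣a[q-p])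
      where
      sum-identity : ∀ a → + 0 ≡ - a + (a + + 0)
      sum-identity = solve-∀
      weighted-identity : ∀ a p q → a * (q - p) ≡ - a * p + (a * q + + 0)
      weighted-identity = solve-∀

  zeroSumWeights-zigzag⇒zeroDivisor : ∀ {p q} → ZeroSumWeights (p ∷ q ∷ p ∷ []) → ZeroDivisor (ι q - ι p)
  zeroSumWeights-zigzag⇒zeroDivisor {p} {q}
    (zeroSumWeights (a₁ ∷ a₂ ∷ a₃ ∷ []) _ (_ ∷ n∤a₂ ∷ _ ∷ []) n∣Σa n∣Σax) =
    a₂ , n∤a₂ , ∣-≡ (identity a₁ a₂ a₃ (ι p) (ι q)) (∣-linear (+ 1) (- ι p) n∣Σax n∣Σa)
    where
    identity : ∀ a₁ a₂ a₃ p q →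
      + 1 * (a₁ * p + (a₂ * q + (a₃ * p + + 0))) + - p * (a₁ + (a₂ + (a₃ + + 0))) ≡ a₂ * (q - p)
    identity = solve-∀

  zeroSumWeights-triple : ∀ {p q r} → Invertible (ι q - ι p) → Invertible (ι r - ι q) → p ≢ r →
    ZeroSumWeights (p ∷ q ∷ r ∷ [])
  zeroSumWeights-triple {p} {q} {r} (e , n∣[q-p]e-1) r-q-invertible p≢r =
    zeroSumWeights (w * e - + 1 ∷ - (w * e) ∷ + 1 ∷ []) refl (n∤a₁ ∷ n∤a₂ ∷ n∤1 ∷ [])
      (∣-≡ (sum-identity w e) ∣0)
      (∣-≡ (weighted-identity (ι p) (ι q) (ι r) e) (∣n⇒∣m*n (- w) n∣[q-p]e-1))
    where
    w : ℤ
    w = ι r - ι p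
    sum-identity : ∀ w e → + 0 ≡ w * e - + 1 + (- (w * e) + (+ 1 + + 0))
    sum-identity = solve-∀
    weighted-identity : ∀ p q r e →
      - (r - p) * ((q - p) * e - + 1) ≡ ((r - p) * e - + 1) * p + (- ((r - p) * e) * q + (+ 1 * r + + 0))
    weighted-identity = solve-∀
    a₁-identity : ∀ p q r e → (q - p) * ((r - p) * e - + 1) + - (r - p) * ((q - p) * e - + 1) ≡ r - q
    a₁-identity = solve-∀
    a₂-identity : ∀ p q r e → - (q - p) * - ((r - p) * e) + - (r - p) * ((q - p) * e - + 1) ≡ r - p
    a₂-identity = solve-∀
    n∤a₁ : ¬ + n ∣ w * e - + 1
    n∤a₁ n∣a₁ = invertible⇒∤ r-q-invertible
      (∣-≡ (a₁-identity (ι p) (ι q) (ι r) e) (∣-linear (ι q - ι p) (- w) n∣a₁ n∣[q-p]e-1))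
    n∤a₂ : ¬ + n ∣ - (w * e)
    n∤a₂ n∣a₂ = p≢r (sym (ι-injective
      (∣-≡ (a₂-identity (ι p) (ι q) (ι r) e) (∣-linear (- (ι q - ι p)) (- w) n∣a₂ n∣[q-p]e-1))))

  zeroSumWeights-alternating : ∀ {p q} → ZeroSumWeights (p ∷ q ∷ p ∷ q ∷ [])
  zeroSumWeights-alternating {p} {q} =
    zeroSumWeights (+ 1 ∷ + 1 ∷ - + 1 ∷ - + 1 ∷ []) refl (n∤1 ∷ n∤1 ∷ ∤-neg n∤1 ∷ ∤-neg n∤1 ∷ [])
      ∣0 (∣-≡ (identity (ι p) (ι q)) ∣0)
    where
    identity : ∀ p q → + 0 ≡ + 1 * p + (+ 1 * q + (- + 1 * p + (- + 1 * q + + 0)))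
    identity = solve-∀

  HasBlock : List (Fin n) → Set
  HasBlock = HasZSBlock n (Zn′ n) (One n)

  zeroSumWeights⇒HasBlock : ∀ {x xs} → ZeroSumWeights (x ∷ xs) → HasBlock (x ∷ xs)
  zeroSumWeights⇒HasBlock {x} {xs} zsw =
    [] , x ∷ xs , [] , sym (++-identityʳ (x ∷ xs)) , (λ ()) , zeroSumWeights⇒WZS zsw

  data UnitZigzag : List (Fin n) → Set where
    zigzag : ∀ {p q} → Invertible (ι q - ι p) → UnitZigzag (p ∷ q ∷ p ∷ [])

  zeroDivisor⇒HasBlock-pair : ∀ {p q} → ZeroDivisor (ι q - ι p) → HasBlock (p ∷ q ∷ [])
  zeroDivisor⇒HasBlock-pair zd = zeroSumWeights⇒HasBlock (Equivalence.from zeroSumWeights-pair⇔ zd)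

  triple-hasBlock-or-zigzag : ∀ p q r → HasBlock (p ∷ q ∷ r ∷ []) ⊎ UnitZigzag (p ∷ q ∷ r ∷ [])
  triple-hasBlock-or-zigzag p q r
    with invertible-or-zeroDivisor (ι q - ι p) | invertible-or-zeroDivisor (ι r - ι q) | p ≟ r
  ... | inj₂ q-p-zd  | _            | _        = inj₁ (HasZSBlock-++ʳ (zeroDivisor⇒HasBlock-pair q-p-zd) (r ∷ []))
  ... | inj₁ _       | inj₂ r-q-zd  | _        = inj₁ (HasZSBlock-∷ p (zeroDivisor⇒HasBlock-pair r-q-zd))
  ... | inj₁ q-p-inv | inj₁ _       | yes refl = inj₂ (zigzag q-p-inv)
  ... | inj₁ q-p-inv | inj₁ r-q-inv | no p≢r   =
    inj₁ (zeroSumWeights⇒HasBlock (zeroSumWeights-triple q-p-inv r-q-inv p≢r))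

  zigzag-blockFree : ∀ {S} → UnitZigzag S → ¬ HasBlock S
  zigzag-blockFree (zigzag {p} {q} q-p-inv) hb with HasZSBlock-triple hb
  ... | inj₁ (_ , w)               = ¬zeroSumWeights-singleton (WZS⇒zeroSumWeights w)
  ... | inj₂ (inj₁ w)              = invertible⇒¬zeroDivisor q-p-inv
                                       (Equivalence.to zeroSumWeights-pair⇔ (WZS⇒zeroSumWeights w))
  ... | inj₂ (inj₂ (inj₁ w))       = invertible⇒¬zeroDivisor (invertible-swap {ι q} {ι p} q-p-inv)
                                       (Equivalence.to zeroSumWeights-pair⇔ (WZS⇒zeroSumWeights w))
  ... | inj₂ (inj₂ (inj₂ w))       = invertible⇒¬zeroDivisor q-p-inv
                                       (zeroSumWeights-zigzag⇒zeroDivisor (WZS⇒zeroSumWeights w))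

  allHaveBlock4 : AllHaveBlock n (Zn′ n) (One n) 4
  allHaveBlock4 (x₁ ∷ x₂ ∷ x₃ ∷ x₄ ∷ []) refl with triple-hasBlock-or-zigzag x₁ x₂ x₃
  ... | inj₁ hb = HasZSBlock-++ʳ hb (x₄ ∷ [])
  ... | inj₂ (zigzag _) with triple-hasBlock-or-zigzag x₂ x₁ x₄
  ...   | inj₁ hb         = HasZSBlock-∷ x₁ hb
  ...   | inj₂ (zigzag _) = zeroSumWeights⇒HasBlock zeroSumWeights-alternating

  isC4 : IsC n (Zn′ n) (One n) 4
  isC4 = s≤s z≤n , allHaveBlock4 , shorter
    where
    shorter : ∀ k → 1 ℕ.≤ k → k ℕ.< 4 → ¬ AllHaveBlock n (Zn′ n) (One n) k
    shorter k _ (s≤s k≤3) all = zigzag-blockFree (zigzag (+ 1 , ∣0))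
      (subst HasBlock (take++drop≡id k S₀₁₀)
        (HasZSBlock-++ʳ (all (take k S₀₁₀) (trans (length-take k S₀₁₀) (ℕ.m≤n⇒m⊓n≡m k≤3)))
                        (drop k S₀₁₀)))

  Equivalent010 : List (Fin n) → Set
  Equivalent010 S = Σ (List (Fin n)) λ T → Σ (List (Fin n)) λ U →
    map toℕ U ≡ 0 ∷ 1 ∷ 0 ∷ [] × OrderEquiv n U T × IsTranslate n T S

  zigzag⇒equivalent010 : ∀ {S} → UnitZigzag S → Equivalent010 S
  zigzag⇒equivalent010 (zigzag {p} {q} q-p-inv) =
    Fin.zero ∷ u ∷ Fin.zero ∷ [] , S₀₁₀ , refl ,
    (u , invertible⇒isUnit-reduce {ι q - ι p} q-p-inv , u*0 ∷ u*1 ∷ u*0 ∷ []) ,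
    (p , p-fixed ∷ q≡u+p ∷ p-fixed ∷ [])
    where
    u : Fin n
    u = reduce (ι q - ι p)
    u*0 : 0 ≡ (toℕ u ℕ.* 0) % n
    u*0 = cong (_% n) (sym (ℕ.*-zeroʳ (toℕ u)))
    u*1 : toℕ u ≡ (toℕ u ℕ.* 1) % n
    u*1 = trans (sym (m<n⇒m%n≡m (toℕ<n u))) (cong (_% n) (sym (ℕ.*-identityʳ (toℕ u))))
    p-fixed : toℕ p ≡ toℕ p % n
    p-fixed = sym (m<n⇒m%n≡m (toℕ<n p))
    identity : ∀ u p q → - + 1 * (u - (q - p)) ≡ q - (u + p)
    identity = solve-∀
    n∣q-[u+p] : + n ∣ ι q - (ι u + ι p)
    n∣q-[u+p] = ∣-≡ (identity (ι u) (ι p) (ι q)) (∣n⇒∣m*n (- + 1) (∣reduce- (ι q - ι p)))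
    q≡u+p : toℕ q ≡ (toℕ u ℕ.+ toℕ p) % n
    q≡u+p = ∣⇒toℕ≡% {q} {toℕ u ℕ.+ toℕ p} (∣-≡ (cong (_-_ (ι q)) (sym (pos-+ (toℕ u) (toℕ p)))) n∣q-[u+p])

  translate⇒zigzag : ∀ {u x s₁ s₂} → IsUnit n u →
    toℕ s₁ ≡ toℕ x % n → toℕ s₂ ≡ (toℕ u ℕ.+ toℕ x) % n → UnitZigzag (s₁ ∷ s₂ ∷ s₁ ∷ [])
  translate⇒zigzag {u} {x} {s₁} {s₂} u-unit s₁≡x s₂≡u+x =
    zigzag (invertible-resp {ι u} {ι s₂ - ι s₁} n∣u-[s₂-s₁] (isUnit⇒invertible {u} u-unit))
    where
    identity : ∀ u x s₁ s₂ → - + 1 * (s₂ - (u + x)) + + 1 * (s₁ - x) ≡ u - (s₂ - s₁)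
    identity = solve-∀
    n∣s₂-[u+x] : + n ∣ ι s₂ - (ι u + ι x)
    n∣s₂-[u+x] = ∣-≡ (cong (_-_ (ι s₂)) (pos-+ (toℕ u) (toℕ x))) (toℕ≡%⇒∣ (toℕ u ℕ.+ toℕ x) s₂≡u+x)
    n∣u-[s₂-s₁] : + n ∣ ι u - (ι s₂ - ι s₁)
    n∣u-[s₂-s₁] = ∣-≡ (identity (ι u) (ι x) (ι s₁) (ι s₂))
                      (∣-linear (- + 1) (+ 1) n∣s₂-[u+x] (toℕ≡%⇒∣ (toℕ x) s₁≡x))

  multiple-of-0 : ∀ {u t : Fin n} → toℕ t ≡ (toℕ u ℕ.* 0) % n → t ≡ Fin.zero
  multiple-of-0 {u} t≡u*0 = toℕ-injective (trans t≡u*0 (cong (_% n) (ℕ.*-zeroʳ (toℕ u))))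

  multiple-of-1 : ∀ {u t : Fin n} → toℕ t ≡ (toℕ u ℕ.* 1) % n → t ≡ u
  multiple-of-1 {u} t≡u*1 = toℕ-injective
    (trans t≡u*1 (trans (cong (_% n) (ℕ.*-identityʳ (toℕ u))) (m<n⇒m%n≡m (toℕ<n u))))

  equivalent010⇒zigzag : ∀ {S} → Equivalent010 S → UnitZigzag S
  equivalent010⇒zigzag (_ , U , U≡010 , _) with map-injective (toℕ-injective {n}) {U} {S₀₁₀} U≡010
  equivalent010⇒zigzag
    (_ , _ , _ , (u , u-unit , t₁≡0 ∷ t₂≡u ∷ t₃≡0 ∷ []) , (x , s₁≡ ∷ s₂≡ ∷ s₃≡ ∷ [])) | refl
    with multiple-of-0 {u} t₁≡0 | multiple-of-1 {u} t₂≡u | multiple-of-0 {u} t₃≡0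
  ... | refl | refl | refl with toℕ-injective {n} (trans s₃≡ (sym s₁≡))
  ... | refl = translate⇒zigzag {u} {x} u-unit s₁≡ s₂≡

  zigzag-length : ∀ {S} → UnitZigzag S → suc (length S) ≡ 4
  zigzag-length (zigzag _) = refl

  blockFree⇒zigzag : ∀ {S} → suc (length S) ≡ 4 → ¬ HasBlock S → UnitZigzag S
  blockFree⇒zigzag {p ∷ q ∷ r ∷ []} refl free with triple-hasBlock-or-zigzag p q r
  ... | inj₁ hb = ⊥-elim (free hb)
  ... | inj₂ zz = zz
  blockFree⇒zigzag {[]} ()
  blockFree⇒zigzag {_ ∷ []} ()
  blockFree⇒zigzag {_ ∷ _ ∷ []} ()
  blockFree⇒zigzag {_ ∷ _ ∷ _ ∷ _ ∷ _} ()

theorem10 : (n : ℕ) .{{_ : NonZero n}} → 2 ≤ n → (S : List (Fin n)) →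
    CExtremal n (Zn′ n) (One n) S ⇔
    Σ (List (Fin n)) λ T → Σ (List (Fin n)) λ U →
      map toℕ U ≡ 0 ∷ 1 ∷ 0 ∷ [] × OrderEquiv n U T × IsTranslate n T S
theorem10 (suc (suc m)) (s≤s (s≤s z≤n)) S = mk⇔
  (λ extremal → let (len , free) = Equivalence.to (CExtremal⇔ isC4) extremal
                in zigzag⇒equivalent010 (blockFree⇒zigzag len free))
  (λ equivalent → let zz = equivalent010⇒zigzag equivalent
                  in Equivalence.from (CExtremal⇔ isC4) (zigzag-length zz , zigzag-blockFree zz))
  where open Extremal m
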